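{- Let $G$ be a path or a cycle and let $I_s,I_t$ be independent sets of $G$. Then the minimum length of a reconfiguration sequence from $I_s$ to $I_t$ is exactly $\mathrm{cc}(I_s\triangle I_t)$.
   Context: For $S\subseteq V(G)$, $\mathrm{cc}(S)$ denotes the number of connected components of the induced subgraph $G[S]$. A reconfiguration sequence from $I_s$ to $I_t$ of length $\ell$ is a sequence $I_s=I_0,I_1,\dots,I_\ell=I_t$ of independent sets of $G$ such that $G[I_{i-1}\triangle I_i]$ is connected for every $i\in\{1,\dots,\ell\}$. -}

module Defs where

open import Data.Nat using (ℕ; zero; suc; _≤_)
open import Data.Fin using (Fin; toℕ)
open import Data.Fin.Subset using (Subset; _∈_)
open import Data.Bool using (_xor_)
open import Data.Vec using (Vec; zipWith; head; last)
import Data.Vec as V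
open import Data.Vec.Relation.Unary.All using (All)
open import Data.Product using (Σ; _×_; ∃)
open import Data.Sum using (_⊎_)
open import Relation.Binary.PropositionalEquality using (_≡_)
open import Relation.Nullary using (¬_)
open import Function using (_⇔_)

record Graph (n : ℕ) : Set₁ where
  field
    Adj : Fin n → Fin n → Set
open Graph public

pathAdj : ∀ {n} → Fin n → Fin n → Set
pathAdj i j = (suc (toℕ i) ≡ toℕ j) ⊎ (suc (toℕ j) ≡ toℕ i)

PathGraph : (n : ℕ) → Graph n
PathGraph n = record { Adj = pathAdj }

-- The cycle C_n (intended for n ≥ 3): path edges plus the edge {0, n-1}.
cycleAdj : ∀ {n} → Fin n → Fin n → Set
cycleAdj {n} i j = pathAdj i j
  ⊎ ((toℕ i ≡ 0 × suc (toℕ j) ≡ n) ⊎ (toℕ j ≡ 0 × suc (toℕ i) ≡ n))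

CycleGraph : (n : ℕ) → Graph n
CycleGraph n = record { Adj = cycleAdj }

data IsPathOrCycle : ∀ {n} → Graph n → Set₁ where
  isPath  : ∀ n → IsPathOrCycle (PathGraph n)
  isCycle : ∀ n → 3 ≤ n → IsPathOrCycle (CycleGraph n)

_△_ : ∀ {n} → Subset n → Subset n → Subset n
p △ q = zipWith _xor_ p q

Independent : ∀ {n} → Graph n → Subset n → Set
Independent G I = ∀ u v → u ∈ I → v ∈ I → ¬ Adj G u v

data Reach {n} (G : Graph n) (S : Subset n) : Fin n → Fin n → Set where
  here : ∀ {u} → u ∈ S → Reach G S u u
  step : ∀ {u v w} → Reach G S u v → Adj G v w → w ∈ S → Reach G S u w

-- G[S] is connected (the empty graph counts as connected).
Connected : ∀ {n} → Graph n → Subset n → Set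
Connected G S = ∀ u v → u ∈ S → v ∈ S → Reach G S u v

-- cc(S) = k: there is a labelling of the vertices of S by Fin k that is onto
-- and identifies exactly the pairs lying in the same component of G[S].
HasCC : ∀ {n} → Graph n → Subset n → ℕ → Set
HasCC {n} G S k = Σ (Fin n → Fin k) λ c →
    (∀ u v → u ∈ S → v ∈ S → (c u ≡ c v ⇔ Reach G S u v))
  × (∀ (a : Fin k) → ∃ λ u → u ∈ S × c u ≡ a)

data Consecutive {A : Set} (R : A → A → Set) : ∀ {m} → Vec A m → Set where
  nil : Consecutive R V.[]
  one : ∀ x → Consecutive R (x V.∷ V.[])
  cons : ∀ {m x y} {xs : Vec A m} → R x y → Consecutive R (y V.∷ xs)
        → Consecutive R (x V.∷ y V.∷ xs)

record ReconfSeq {n} (G : Graph n) (Is It : Subset n) (ℓ : ℕ) : Set where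
  field
    sets        : Vec (Subset n) (suc ℓ)
    starts      : head sets ≡ Is
    ends        : last sets ≡ It
    independent : All (Independent G) sets
    steps       : Consecutive (λ A B → Connected G (A △ B)) sets

module Submission where

-- Write S = Is △ It.
-- Upper bound: label the components of G[S] by 0, …, k − 1 and switch them from Is to It one
-- label at a time. Every intermediate set is independent: an edge from a switched vertex (in It)
-- to an unswitched one (in Is) lies inside It or inside Is unless both ends are in S, and then
-- they are in one component and were switched together. Consecutive sets differ by one component.
-- Lower bound: on a path the components of a set are its runs of consecutive vertices, counted by
-- their first vertices (cyclically on a cycle, where only the whole cycle is a run without a first
-- vertex). The number of run starts is subadditive under △ and at most 1 for a connected set, so
-- along a reconfiguration sequence the run starts of I_i △ It drop by at most one per step, from
-- at least cc(S) down to 0.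

open import Defs
open import Data.Nat using (ℕ; zero; suc; _+_; _≤_; _<_; z≤n; s≤s; _<ᵇ_; _≡ᵇ_)
open import Data.Bool using (Bool; true; false; not; _∧_; _xor_; if_then_else_)
open import Data.Bool.Properties using (xor-same; xor-comm; T-≡)
open import Data.Empty using (⊥; ⊥-elim)
open import Data.Fin using (Fin; zero; suc; toℕ; inject₁; fromℕ)
open import Data.Fin.Properties using (toℕ-injective; toℕ-inject₁; toℕ-fromℕ; toℕ<n; injective⇒≤)
  renaming (suc-injective to Fin-suc-injective)
open import Data.Fin.Subset using (Subset; _∈_; _∉_; ∣_∣; ⁅_⁆; inside; outside)
  renaming (⊥ to ∅)
open import Data.Fin.Subset.Properties
  using (_∈?_; nonempty?; Empty-unique; ∣⊥∣≡0; ∣⁅x⁆∣≡1; x∈⁅x⁆; p⊆q⇒∣p∣≤∣q∣; ∉⊥)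
open import Data.Nat.Properties
open import Data.Nat.Tactic.RingSolver using (solve-∀)
open import Data.Product using (_×_; ∃; _,_; proj₁; proj₂)
open import Data.Sum using (_⊎_; inj₁; inj₂; [_,_])
open import Data.Vec using (Vec; []; _∷_; lookup; tabulate; head; last; here; there)
open import Data.Vec.Properties
  using (lookup-zipWith; lookup∘tabulate; tabulate∘lookup; tabulate-cong; lookup-replicate; []=⇒lookup; lookup⇒[]=)
open import Data.Vec.Relation.Unary.All using ([]; _∷_)
open import Function using (_∘_; _⇔_; Equivalence)
open import Function.Definitions using (Injective)
open import Relation.Binary using (tri<; tri≈; tri>)
open import Relation.Binary.PropositionalEquality
  using (_≡_; _≢_; refl; sym; trans; cong; cong₂; subst; subst₂; module ≡-Reasoning)
open import Relation.Nullary using (¬_; yes; no)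

true≢false : true ≢ false
true≢false ()

∧-not≡true⁻ : ∀ {a b} → a ∧ not b ≡ true → a ≡ true × b ≡ false
∧-not≡true⁻ {true} {false} _ = refl , refl
∧-not≡true⁻ {true} {true} ()
∧-not≡true⁻ {false} ()

∧≡true⁻ : ∀ {a b} → a ∧ b ≡ true → a ≡ true × b ≡ true
∧≡true⁻ {true} {true} _ = refl , refl
∧≡true⁻ {true} {false} ()
∧≡true⁻ {false} ()

if-xor : ∀ a b (s t : Bool) → (if a then t else s) xor (if b then t else s) ≡ (a xor b) ∧ (s xor t)
if-xor true  true  s t = xor-same t
if-xor true  false s t = xor-comm t s
if-xor false true  s t = refl
if-xor false false s t = xor-same s

<ᵇ-xor-<ᵇ-suc : ∀ x j → (x <ᵇ j) xor (x <ᵇ suc j) ≡ (x ≡ᵇ j)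
<ᵇ-xor-<ᵇ-suc zero    zero    = refl
<ᵇ-xor-<ᵇ-suc zero    (suc j) = refl
<ᵇ-xor-<ᵇ-suc (suc x) zero    = refl
<ᵇ-xor-<ᵇ-suc (suc x) (suc j) = <ᵇ-xor-<ᵇ-suc x j

⟦_⟧ : Bool → ℕ
⟦ true ⟧ = 1
⟦ false ⟧ = 0

lookup-△ : ∀ {n} (p q : Subset n) v → lookup (p △ q) v ≡ lookup p v xor lookup q v
lookup-△ p q v = lookup-zipWith _xor_ v p q

∉⇒lookup≡false : ∀ {n} {S : Subset n} {v} → v ∉ S → lookup S v ≡ false
∉⇒lookup≡false {S = S} {v} v∉S with lookup S v in eq
... | true = ⊥-elim (v∉S (lookup⇒[]= v S eq))
... | false = refl

∈-△⁺ˡ : ∀ {n} {p q : Subset n} {v} → v ∈ p → v ∉ q → v ∈ p △ q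
∈-△⁺ˡ {p = p} {q} {v} v∈p v∉q = lookup⇒[]= v (p △ q)
  (trans (lookup-△ p q v) (cong₂ _xor_ ([]=⇒lookup v∈p) (∉⇒lookup≡false v∉q)))

∈-△⁺ʳ : ∀ {n} {p q : Subset n} {v} → v ∉ p → v ∈ q → v ∈ p △ q
∈-△⁺ʳ {p = p} {q} {v} v∉p v∈q = lookup⇒[]= v (p △ q)
  (trans (lookup-△ p q v) (cong₂ _xor_ (∉⇒lookup≡false v∉p) ([]=⇒lookup v∈q)))

Subset-ext : ∀ {n} {p q : Subset n} → (∀ v → lookup p v ≡ lookup q v) → p ≡ q
Subset-ext {p = p} {q} eq = trans (sym (tabulate∘lookup p)) (trans (tabulate-cong eq) (tabulate∘lookup q))

△-self : ∀ {n} (p : Subset n) → p △ p ≡ ∅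
△-self p = Subset-ext λ v → trans (lookup-△ p p v) (trans (xor-same (lookup p v)) (sym (lookup-replicate v false)))

△-shift : ∀ {n} (A B T : Subset n) → (B △ T) △ (A △ B) ≡ A △ T
△-shift A B T = Subset-ext λ v → begin
  lookup ((B △ T) △ (A △ B)) v                            ≡⟨ lookup-△ (B △ T) (A △ B) v ⟩
  lookup (B △ T) v xor lookup (A △ B) v                  ≡⟨ cong₂ _xor_ (lookup-△ B T v) (lookup-△ A B v) ⟩
  (lookup B v xor lookup T v) xor (lookup A v xor lookup B v) ≡⟨ shift (lookup A v) (lookup B v) (lookup T v) ⟩
  lookup A v xor lookup T v                              ≡⟨ sym (lookup-△ A T v) ⟩
  lookup (A △ T) v                                       ∎
  where
  open ≡-Reasoning
  shift : ∀ a b t → (b xor t) xor (a xor b) ≡ a xor t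
  shift true  true  true  = refl
  shift true  true  false = refl
  shift true  false true  = refl
  shift true  false false = refl
  shift false true  true  = refl
  shift false true  false = refl
  shift false false true  = refl
  shift false false false = refl

∣∷∣ : ∀ {n} b (p : Subset n) → ∣ b ∷ p ∣ ≡ ⟦ b ⟧ + ∣ p ∣
∣∷∣ true p = refl
∣∷∣ false p = refl

unique-member⇒∣p∣≤1 : ∀ {n} {p : Subset n} → (∀ {x y} → x ∈ p → y ∈ p → x ≡ y) → ∣ p ∣ ≤ 1
unique-member⇒∣p∣≤1 {n} {p} unique with nonempty? p
... | yes (x , x∈p) = ≤-trans (p⊆q⇒∣p∣≤∣q∣ (λ y∈p → subst (_∈ ⁅ x ⁆) (unique x∈p y∈p) (x∈⁅x⁆ x)))
                                (≤-reflexive (∣⁅x⁆∣≡1 x))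
... | no empty = ≤-trans (≤-reflexive (trans (cong ∣_∣ (Empty-unique empty)) (∣⊥∣≡0 n))) z≤n

index : ∀ {n} {p : Subset n} {x} → x ∈ p → Fin ∣ p ∣
index here = zero
index {p = inside ∷ p} (there x∈p) = suc (index x∈p)
index {p = outside ∷ p} (there x∈p) = index x∈p

index-injective : ∀ {n} {p : Subset n} {x y} (x∈p : x ∈ p) (y∈p : y ∈ p) → index x∈p ≡ index y∈p → x ≡ y
index-injective here here _ = refl
index-injective {p = inside ∷ p} here (there _) ()
index-injective {p = inside ∷ p} (there _) here ()
index-injective {p = inside ∷ p} (there x∈p) (there y∈p) eq =
  cong suc (index-injective x∈p y∈p (Fin-suc-injective eq))
index-injective {p = outside ∷ p} (there x∈p) (there y∈p) eq = cong suc (index-injective x∈p y∈p eq)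

injection⇒≤∣∣ : ∀ {n k} {p : Subset n} (f : Fin k → Fin n) →
  (∀ a → f a ∈ p) → Injective _≡_ _≡_ f → k ≤ ∣ p ∣
injection⇒≤∣∣ f f∈p f-inj =
  injective⇒≤ (λ {a} {b} eq → f-inj (index-injective (f∈p a) (f∈p b) eq))

-- Reachability, components and reconfiguration sequences

module _ {n} {G : Graph n} where

  reach-source : ∀ {S u v} → Reach G S u v → u ∈ S
  reach-source (here u∈S) = u∈S
  reach-source (step r _ _) = reach-source r

  reach-target : ∀ {S u v} → Reach G S u v → v ∈ S
  reach-target (here v∈S) = v∈S
  reach-target (step _ _ v∈S) = v∈S

  reach-trans : ∀ {S u v w} → Reach G S u v → Reach G S v w → Reach G S u w
  reach-trans r (here _) = r
  reach-trans r (step r′ a w∈S) = step (reach-trans r r′) a w∈S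

  reach-restrict : ∀ {S D u v} → (∀ {w} → Reach G S u w → w ∈ D) → Reach G S u v → Reach G D u v
  reach-restrict close r@(here _) = here (close r)
  reach-restrict close r@(step r′ a _) = step (reach-restrict close r′) a (close r)

  cc≤∣∣ : ∀ {k S P} → HasCC G S k → (∀ {u} → u ∈ S → ∃ λ s → s ∈ P × Reach G S s u) → k ≤ ∣ P ∣
  cc≤∣∣ {S = S} (c , iff , onto) cover = injection⇒≤∣∣ rep (proj₁ ∘ proj₂ ∘ cover′) rep-injective
    where
    cover′ : ∀ a → ∃ λ s → s ∈ _ × Reach G S s (proj₁ (onto a))
    cover′ a = cover (proj₁ (proj₂ (onto a)))
    rep : Fin _ → Fin n
    rep a = proj₁ (cover′ a)
    c-rep : ∀ a → c (rep a) ≡ a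
    c-rep a with onto a | cover′ a
    ... | u , u∈S , cu≡a | s , _ , r = trans (Equivalence.from (iff s u (reach-source r) u∈S) r) cu≡a
    rep-injective : Injective _≡_ _≡_ rep
    rep-injective {a} {b} eq = trans (sym (c-rep a)) (trans (cong c eq) (c-rep b))

  cc-empty : ∀ {k} → HasCC G ∅ k → k ≡ 0
  cc-empty {zero} _ = refl
  cc-empty {suc k} (_ , _ , onto) = ⊥-elim (∉⊥ (proj₁ (proj₂ (onto zero))))

  -- Each step changes the distance I △ It to the target by a connected set: (B △ It) △ (A △ B) = A △ It.
  potential≤length : (F : Subset n → ℕ) → F ∅ ≡ 0 →
    (∀ X D → Connected G D → F (X △ D) ≤ F X + 1) →
    ∀ {Is It ℓ} → ReconfSeq G Is It ℓ → F (Is △ It) ≤ ℓ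
  potential≤length F F-∅ F-step record { sets = sets ; starts = refl ; ends = refl ; steps = steps } =
    along sets steps
    where
    along : ∀ {ℓ} (sets : Vec (Subset n) (suc ℓ)) → Consecutive (λ A B → Connected G (A △ B)) sets →
      F (head sets △ last sets) ≤ ℓ
    along (A ∷ []) (one _) = ≤-reflexive (trans (cong F (△-self A)) F-∅)
    along {suc ℓ} (A ∷ B ∷ rest) (cons A△B-connected steps) = begin
      F (A △ T)             ≡⟨ cong F (sym (△-shift A B T)) ⟩
      F ((B △ T) △ (A △ B)) ≤⟨ F-step (B △ T) (A △ B) A△B-connected ⟩
      F (B △ T) + 1         ≤⟨ +-monoˡ-≤ 1 (along (B ∷ rest) steps) ⟩
      ℓ + 1                 ≡⟨ +-comm ℓ 1 ⟩
      suc ℓ                 ∎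
      where
      open ≤-Reasoning
      T = last (B ∷ rest)

  cc≤1⇒cc≤length : ∀ {Is It k ℓ} → HasCC G (Is △ It) k → k ≤ 1 → ReconfSeq G Is It ℓ → k ≤ ℓ
  cc≤1⇒cc≤length {ℓ = suc ℓ} _ k≤1 _ = ≤-trans k≤1 (s≤s z≤n)
  cc≤1⇒cc≤length {k = k} {zero} cc _ record { sets = A ∷ [] ; starts = refl ; ends = refl } =
    ≤-reflexive (cc-empty (subst (λ S → HasCC G S k) (△-self A) cc))

  ReconfSeq-[] : ∀ {A} → Independent G A → ReconfSeq G A A 0
  ReconfSeq-[] {A} A-ind = record
    { sets = A ∷ [] ; starts = refl ; ends = refl ; independent = A-ind ∷ [] ; steps = one A }

  ReconfSeq-∷ : ∀ {A B C ℓ} → Independent G A → Connected G (A △ B) → ReconfSeq G B C ℓ → ReconfSeq G A C (suc ℓ)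
  ReconfSeq-∷ {A} A-ind A△B-connected
    record { sets = B ∷ rest ; starts = refl ; ends = ends ; independent = independent ; steps = steps } = record
    { sets = A ∷ B ∷ rest ; starts = refl ; ends = ends
    ; independent = A-ind ∷ independent ; steps = cons A△B-connected steps }

  ReconfSeq-stages : (I : ℕ → Subset n) → (∀ j → Independent G (I j)) →
    (∀ j → Connected G (I j △ I (suc j))) → ∀ ℓ → ReconfSeq G (I 0) (I ℓ) ℓ
  ReconfSeq-stages I independent _ zero = ReconfSeq-[] (independent 0)
  ReconfSeq-stages I independent connected (suc ℓ) = ReconfSeq-∷ (independent 0) (connected 0)
    (ReconfSeq-stages (I ∘ suc) (independent ∘ suc) (connected ∘ suc) ℓ)

-- Runs of a subset of a path or a cycle

-- prev p X v is the entry of X just before position v, with p standing in before position 0.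
prev : ∀ {m} → Bool → Vec Bool m → Fin m → Bool
prev p _ zero = p
prev p X (suc i) = lookup X (inject₁ i)

runStarts : ∀ {m} → Bool → Subset m → Subset m
runStarts p [] = []
runStarts p (x ∷ X) = (x ∧ not p) ∷ runStarts x X

lastOr : ∀ {m} → Bool → Vec Bool m → Bool
lastOr p [] = p
lastOr p (x ∷ X) = lastOr x X

cyclicRunStarts : ∀ {m} → Subset (suc m) → Subset (suc m)
cyclicRunStarts (x ∷ X) = runStarts (lastOr x X) (x ∷ X)

prev-∷ : ∀ {m} p x (X : Vec Bool m) i → prev x X i ≡ prev p (x ∷ X) (suc i)
prev-∷ p x X zero = refl
prev-∷ p x X (suc i) = refl

lookup-runStarts : ∀ {m} p (X : Subset m) v → lookup (runStarts p X) v ≡ lookup X v ∧ not (prev p X v)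
lookup-runStarts p (x ∷ X) zero = refl
lookup-runStarts p (x ∷ X) (suc i) =
  trans (lookup-runStarts x X i) (cong (λ b → lookup X i ∧ not b) (prev-∷ p x X i))

∈-runStarts⁻ : ∀ {m p} {X : Subset m} {v} → v ∈ runStarts p X → v ∈ X × prev p X v ≡ false
∈-runStarts⁻ {p = p} {X} {v} v∈ with ∧-not≡true⁻ (trans (sym (lookup-runStarts p X v)) ([]=⇒lookup v∈))
... | v∈X , prev≡false = lookup⇒[]= v X v∈X , prev≡false

∈-runStarts⁺ : ∀ {m p} {X : Subset m} {v} → v ∈ X → prev p X v ≡ false → v ∈ runStarts p X
∈-runStarts⁺ {p = p} {X} {v} v∈X prev≡false = lookup⇒[]= v (runStarts p X) (begin
  lookup (runStarts p X) v      ≡⟨ lookup-runStarts p X v ⟩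
  lookup X v ∧ not (prev p X v) ≡⟨ cong₂ (λ a b → a ∧ not b) ([]=⇒lookup v∈X) prev≡false ⟩
  true                          ∎)
  where open ≡-Reasoning

prev-after : ∀ {m p} {X : Subset m} {v t} → v ∈ X → suc (toℕ v) ≡ toℕ t → prev p X t ≡ true
prev-after {X = X} {v} {suc i} v∈X eq =
  trans (cong (lookup X) (toℕ-injective (trans (toℕ-inject₁ i) (sym (suc-injective eq))))) ([]=⇒lookup v∈X)

lookup-fromℕ : ∀ {m} x (X : Vec Bool m) → lookup (x ∷ X) (fromℕ m) ≡ lastOr x X
lookup-fromℕ x [] = refl
lookup-fromℕ x (y ∷ X) = lookup-fromℕ y X

lastOr-△ : ∀ {m} p q (X D : Subset m) → lastOr (p xor q) (X △ D) ≡ lastOr p X xor lastOr q D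
lastOr-△ p q [] [] = refl
lastOr-△ p q (x ∷ X) (d ∷ D) = lastOr-△ x d X D

runStarts-∅ : ∀ {m} p → runStarts p (∅ {m}) ≡ ∅
runStarts-∅ {zero} p = refl
runStarts-∅ {suc m} p = cong (false ∷_) (runStarts-∅ false)

-- At position i, with x, d the current and p, q the previous entries of X and D: a run of X △ D
-- starting at i is paid for by a run of X or of D starting at i, or by X ∩ D being left at i.
runStart-△-local : ∀ x d p q →
  ⟦ (x xor d) ∧ not (p xor q) ⟧ + ⟦ x ∧ d ⟧ ≤ ⟦ x ∧ not p ⟧ + ⟦ d ∧ not q ⟧ + ⟦ p ∧ q ⟧
runStart-△-local true  true  true  true  = ≤ᵇ⇒≤ _ _ _
runStart-△-local true  true  true  false = ≤ᵇ⇒≤ _ _ _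
runStart-△-local true  true  false true  = ≤ᵇ⇒≤ _ _ _
runStart-△-local true  true  false false = ≤ᵇ⇒≤ _ _ _
runStart-△-local true  false true  true  = ≤ᵇ⇒≤ _ _ _
runStart-△-local true  false true  false = ≤ᵇ⇒≤ _ _ _
runStart-△-local true  false false true  = ≤ᵇ⇒≤ _ _ _
runStart-△-local true  false false false = ≤ᵇ⇒≤ _ _ _
runStart-△-local false true  true  true  = ≤ᵇ⇒≤ _ _ _
runStart-△-local false true  true  false = ≤ᵇ⇒≤ _ _ _
runStart-△-local false true  false true  = ≤ᵇ⇒≤ _ _ _
runStart-△-local false true  false false = ≤ᵇ⇒≤ _ _ _
runStart-△-local false false true  true  = ≤ᵇ⇒≤ _ _ _
runStart-△-local false false true  false = ≤ᵇ⇒≤ _ _ _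
runStart-△-local false false false true  = ≤ᵇ⇒≤ _ _ _
runStart-△-local false false false false = ≤ᵇ⇒≤ _ _ _

+-telescope-≤ : ∀ {a b d f A B C c e} → A + c ≤ B + C + e → a + e ≤ b + d + f →
  (a + A) + c ≤ (b + B) + (d + C) + f
+-telescope-≤ {a} {b} {d} {f} {A} {B} {C} {c} {e} tail head = begin
  (a + A) + c         ≡⟨ +-assoc a A c ⟩
  a + (A + c)         ≤⟨ +-monoʳ-≤ a tail ⟩
  a + (B + C + e)     ≡⟨ regroup₁ a B C e ⟩
  (a + e) + (B + C)   ≤⟨ +-monoˡ-≤ (B + C) head ⟩
  (b + d + f) + (B + C) ≡⟨ regroup₂ b d f B C ⟩
  (b + B) + (d + C) + f ∎
  where
  open ≤-Reasoning
  regroup₁ : ∀ a B C e → a + (B + C + e) ≡ (a + e) + (B + C)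
  regroup₁ = solve-∀
  regroup₂ : ∀ b d f B C → (b + d + f) + (B + C) ≡ (b + B) + (d + C) + f
  regroup₂ = solve-∀

∣runStarts-△∣ : ∀ {m} p q (X D : Subset m) →
  ∣ runStarts (p xor q) (X △ D) ∣ + ⟦ lastOr p X ∧ lastOr q D ⟧
    ≤ ∣ runStarts p X ∣ + ∣ runStarts q D ∣ + ⟦ p ∧ q ⟧
∣runStarts-△∣ p q [] [] = ≤-refl
∣runStarts-△∣ p q (x ∷ X) (d ∷ D) = begin
  ∣ y ∷ Y ∣ + c                  ≡⟨ cong (_+ c) (∣∷∣ y Y) ⟩
  (⟦ y ⟧ + ∣ Y ∣) + c            ≤⟨ +-telescope-≤ {a = ⟦ y ⟧} {b = ⟦ x′ ⟧} {d = ⟦ d′ ⟧} {A = ∣ Y ∣} {B = ∣ X′ ∣} {C = ∣ D′ ∣}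
                                     (∣runStarts-△∣ x d X D) (runStart-△-local x d p q) ⟩
  (⟦ x′ ⟧ + ∣ X′ ∣) + (⟦ d′ ⟧ + ∣ D′ ∣) + ⟦ p ∧ q ⟧
    ≡⟨ sym (cong₂ (λ m n → m + n + ⟦ p ∧ q ⟧) (∣∷∣ x′ X′) (∣∷∣ d′ D′)) ⟩
  ∣ x′ ∷ X′ ∣ + ∣ d′ ∷ D′ ∣ + ⟦ p ∧ q ⟧ ∎
  where
  open ≤-Reasoning
  y = (x xor d) ∧ not (p xor q)
  Y = runStarts (x xor d) (X △ D)
  c = ⟦ lastOr x X ∧ lastOr d D ⟧
  x′ = x ∧ not p
  X′ = runStarts x X
  d′ = d ∧ not q
  D′ = runStarts d D

∣runStarts-△∣≤ : ∀ {m} (X D : Subset m) →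
  ∣ runStarts false (X △ D) ∣ ≤ ∣ runStarts false X ∣ + ∣ runStarts false D ∣
∣runStarts-△∣≤ X D = ≤-trans (m≤m+n _ _) (≤-trans (∣runStarts-△∣ false false X D) (≤-reflexive (+-identityʳ _)))

∣cyclicRunStarts-△∣≤ : ∀ {m} (X D : Subset (suc m)) →
  ∣ cyclicRunStarts (X △ D) ∣ ≤ ∣ cyclicRunStarts X ∣ + ∣ cyclicRunStarts D ∣
∣cyclicRunStarts-△∣≤ (x ∷ X) (d ∷ D) = +-cancelʳ-≤ carry _ _
  (subst (λ p → ∣ runStarts p ((x ∷ X) △ (d ∷ D)) ∣ + carry
                  ≤ ∣ cyclicRunStarts (x ∷ X) ∣ + ∣ cyclicRunStarts (d ∷ D) ∣ + carry)
         (sym (lastOr-△ x d X D))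
         (∣runStarts-△∣ (lastOr x X) (lastOr d D) (x ∷ X) (d ∷ D)))
  where carry = ⟦ lastOr x X ∧ lastOr d D ⟧

runStarts≤1 : ∀ {n} {G : Graph n} {p} {D : Subset n} →
  (∀ {s t} → s ∈ runStarts p D → t ∈ runStarts p D → toℕ s < toℕ t → ¬ Reach G D s t) →
  Connected G D → ∣ runStarts p D ∣ ≤ 1
runStarts≤1 {p = p} {D} separated connected = unique-member⇒∣p∣≤1 unique
  where
  joined : ∀ {s t} → s ∈ runStarts p D → t ∈ runStarts p D → Reach _ D s t
  joined {s} {t} s∈ t∈ = connected s t (proj₁ (∈-runStarts⁻ s∈)) (proj₁ (∈-runStarts⁻ t∈))
  unique : ∀ {s t} → s ∈ runStarts p D → t ∈ runStarts p D → s ≡ t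
  unique {s} {t} s∈ t∈ with <-cmp (toℕ s) (toℕ t)
  ... | tri< s<t _ _ = ⊥-elim (separated s∈ t∈ s<t (joined s∈ t∈))
  ... | tri≈ _ s≡t _ = toℕ-injective s≡t
  ... | tri> _ _ t<s = ⊥-elim (separated t∈ s∈ t<s (joined t∈ s∈))

path-step-between : ∀ {m p} {D : Subset m} {s t v w} → prev p D s ≡ false → prev p D t ≡ false →
  v ∈ D → w ∈ D → toℕ s ≤ toℕ v → toℕ v < toℕ t → pathAdj v w → toℕ s ≤ toℕ w × toℕ w < toℕ t
path-step-between {t = t} {v} _ t-start v∈D _ s≤v v<t (inj₁ v+1≡w) =
  ≤-trans s≤v (subst (toℕ v ≤_) v+1≡w (n≤1+n (toℕ v))) , w<t
  where
  w<t : toℕ _ < toℕ t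
  w<t with m≤n⇒m<n∨m≡n v<t
  ... | inj₁ v+1<t = subst (_< toℕ t) v+1≡w v+1<t
  ... | inj₂ v+1≡t = ⊥-elim (true≢false (trans (sym (prev-after v∈D v+1≡t)) t-start))
path-step-between {s = s} {v = v} {w} s-start _ _ w∈D s≤v v<t (inj₂ w+1≡v) =
  s≤w , <-trans (subst (toℕ w <_) w+1≡v ≤-refl) v<t
  where
  s≤w : toℕ s ≤ toℕ w
  s≤w with m≤n⇒m<n∨m≡n s≤v
  ... | inj₁ s<v = ≤-pred (subst (toℕ s <_) (sym w+1≡v) s<v)
  ... | inj₂ s≡v = ⊥-elim (true≢false (trans (sym (prev-after w∈D (trans w+1≡v (sym s≡v)))) s-start))

path-reach-between : ∀ {m p} {D : Subset m} {s t w} → prev p D s ≡ false → prev p D t ≡ false →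
  toℕ s < toℕ t → Reach (PathGraph m) D s w → toℕ s ≤ toℕ w × toℕ w < toℕ t
path-reach-between _ _ s<t (here _) = ≤-refl , s<t
path-reach-between s-start t-start s<t (step r adj w∈D) =
  let s≤v , v<t = path-reach-between s-start t-start s<t r
  in path-step-between s-start t-start (reach-target r) w∈D s≤v v<t adj

cycle-reach-between : ∀ {m p} {D : Subset (suc m)} {s t w} → p ≡ lookup D (fromℕ m) →
  prev p D s ≡ false → prev p D t ≡ false →
  toℕ s < toℕ t → Reach (CycleGraph (suc m)) D s w → toℕ s ≤ toℕ w × toℕ w < toℕ t
cycle-reach-between _ _ _ s<t (here _) = ≤-refl , s<t
cycle-reach-between {m} {p} {D} {s} {t} p≡last s-start t-start s<t (step {v = v} {w = w} r adj w∈D)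
  with cycle-reach-between p≡last s-start t-start s<t r
... | s≤v , v<t with adj
...   | inj₁ path-edge = path-step-between s-start t-start (reach-target r) w∈D s≤v v<t path-edge
...   | inj₂ (inj₂ (_ , v+1≡n)) = ⊥-elim (<⇒≱ (toℕ<n t) (subst (_≤ toℕ t) v+1≡n v<t))
...   | inj₂ (inj₁ (v≡0 , w+1≡n)) = ⊥-elim (true≢false (trans (sym last∈D) p≡false))
  where
  s≡0 : s ≡ zero
  s≡0 = toℕ-injective (n≤0⇒n≡0 (subst (toℕ s ≤_) v≡0 s≤v))
  p≡false : p ≡ false
  p≡false = subst (λ x → prev p D x ≡ false) s≡0 s-start
  last∈D : p ≡ true
  last∈D = trans p≡last (trans (cong (lookup D) (toℕ-injective (trans (toℕ-fromℕ m) (sym (suc-injective w+1≡n)))))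
                                ([]=⇒lookup w∈D))

path-runStarts≤1 : ∀ {m} {D : Subset m} → Connected (PathGraph m) D → ∣ runStarts false D ∣ ≤ 1
path-runStarts≤1 = runStarts≤1 λ s∈ t∈ s<t r →
  <-irrefl refl (proj₂ (path-reach-between (proj₂ (∈-runStarts⁻ s∈)) (proj₂ (∈-runStarts⁻ t∈)) s<t r))

cycle-runStarts≤1 : ∀ {m} {D : Subset (suc m)} → Connected (CycleGraph (suc m)) D → ∣ cyclicRunStarts D ∣ ≤ 1
cycle-runStarts≤1 {D = x ∷ X} = runStarts≤1 λ s∈ t∈ s<t r →
  <-irrefl refl (proj₂ (cycle-reach-between (sym (lookup-fromℕ x X))
    (proj₂ (∈-runStarts⁻ s∈)) (proj₂ (∈-runStarts⁻ t∈)) s<t r))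

walk-left : ∀ {m} {G : Graph (suc m)} → (∀ (i : Fin m) → Adj G (inject₁ i) (suc i)) →
  ∀ p (S : Subset (suc m)) t {u} → toℕ u ≡ t → u ∈ S →
  (∃ λ s → s ∈ runStarts p S × Reach G S s u)
    ⊎ (p ≡ true × Reach G S zero u × (∀ v → toℕ v ≤ toℕ u → v ∈ S))
walk-left forward false S _ {zero} _ u∈S = inj₁ (zero , ∈-runStarts⁺ u∈S refl , here u∈S)
walk-left forward true S _ {zero} _ u∈S = inj₂ (refl , here u∈S , λ { zero _ → u∈S })
walk-left forward p S (suc t) {suc i} 1+i≡1+t u∈S with inject₁ i ∈? S
... | no i∉S = inj₁ (suc i , ∈-runStarts⁺ u∈S (∉⇒lookup≡false i∉S) , here u∈S)
... | yes i∈S with walk-left forward p S t (trans (toℕ-inject₁ i) (suc-injective 1+i≡1+t)) i∈S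
...   | inj₁ (s , s∈ , r) = inj₁ (s , s∈ , step r (forward i) u∈S)
...   | inj₂ (p≡true , r , prefix) = inj₂ (p≡true , step r (forward i) u∈S , prefix′)
  where
  prefix′ : ∀ v → toℕ v ≤ suc (toℕ i) → v ∈ S
  prefix′ v v≤1+i with m≤n⇒m<n∨m≡n v≤1+i
  ... | inj₁ v<1+i = prefix v (subst (toℕ v ≤_) (sym (toℕ-inject₁ i)) (≤-pred v<1+i))
  ... | inj₂ v≡1+i = subst (_∈ S) (sym (toℕ-injective {i = v} {j = suc i} v≡1+i)) u∈S

path-forward : ∀ {m} (i : Fin m) → pathAdj (inject₁ i) (suc i)
path-forward i = inj₁ (cong suc (toℕ-inject₁ i))

path-cc≤runStarts : ∀ {n k} {S : Subset n} → HasCC (PathGraph n) S k → k ≤ ∣ runStarts false S ∣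
path-cc≤runStarts {zero} {S = S} cc = cc≤∣∣ {P = runStarts false S} cc λ { {()} }
path-cc≤runStarts {suc m} {S = S} cc = cc≤∣∣ cc cover
  where
  cover : ∀ {u} → u ∈ S → ∃ λ s → s ∈ runStarts false S × Reach (PathGraph (suc m)) S s u
  cover u∈S with walk-left path-forward false S _ refl u∈S
  ... | inj₁ found = found
  ... | inj₂ (() , _)

cycle-forward : ∀ {m} (i : Fin m) → cycleAdj {suc m} (inject₁ i) (suc i)
cycle-forward i = inj₁ (path-forward i)

cycle-cc≤runStarts : ∀ {m k} {S : Subset (suc m)} → HasCC (CycleGraph (suc m)) S k →
  k ≤ ∣ cyclicRunStarts S ∣ ⊎ k ≤ 1
cycle-cc≤runStarts {m} {S = x ∷ X} cc with fromℕ m ∈? (x ∷ X)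
... | no last∉S = inj₁ (cc≤∣∣ cc cover)
  where
  cover : ∀ {u} → u ∈ x ∷ X → ∃ λ s → s ∈ cyclicRunStarts (x ∷ X) × Reach (CycleGraph (suc m)) (x ∷ X) s u
  cover u∈S with walk-left cycle-forward (lastOr x X) (x ∷ X) _ refl u∈S
  ... | inj₁ found = found
  ... | inj₂ (last≡true , _) = ⊥-elim (last∉S (lookup⇒[]= (fromℕ m) (x ∷ X) (trans (lookup-fromℕ x X) last≡true)))
... | yes last∈S with walk-left cycle-forward (lastOr x X) (x ∷ X) _ refl last∈S
...   | inj₁ (s , s∈ , s↝last) = inj₁ (cc≤∣∣ cc cover)
  where
  wrap : cycleAdj {suc m} (fromℕ m) zero
  wrap = inj₂ (inj₂ (refl , cong suc (toℕ-fromℕ m)))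
  cover : ∀ {u} → u ∈ x ∷ X → ∃ λ s → s ∈ cyclicRunStarts (x ∷ X) × Reach (CycleGraph (suc m)) (x ∷ X) s u
  cover u∈S with walk-left cycle-forward (lastOr x X) (x ∷ X) _ refl u∈S
  ... | inj₁ found = found
  ... | inj₂ (_ , 0↝u , _) = s , s∈ , reach-trans (step s↝last wrap (reach-source 0↝u)) 0↝u
-- S is the whole cycle: it has no cyclic run starts, but every vertex is reached from 0.
...   | inj₂ (last≡true , _ , prefix) =
  inj₂ (≤-trans (cc≤∣∣ {P = ⁅ zero ⁆} cc cover) (≤-reflexive (∣⁅x⁆∣≡1 {suc m} zero)))
  where
  full : ∀ v → v ∈ x ∷ X
  full v = prefix v (subst (toℕ v ≤_) (sym (toℕ-fromℕ m)) (≤-pred (toℕ<n v)))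
  no-start : ∀ s → prev (lastOr x X) (x ∷ X) s ≡ true
  no-start zero = last≡true
  no-start (suc i) = []=⇒lookup (full (inject₁ i))
  cover : ∀ {u} → u ∈ x ∷ X → ∃ λ s → s ∈ ⁅ zero ⁆ × Reach (CycleGraph (suc m)) (x ∷ X) s u
  cover u∈S with walk-left cycle-forward (lastOr x X) (x ∷ X) _ refl u∈S
  ... | inj₁ (s , s∈ , _) = ⊥-elim (true≢false (trans (sym (no-start s)) (proj₂ (∈-runStarts⁻ s∈))))
  ... | inj₂ (_ , 0↝u , _) = zero , x∈⁅x⁆ zero , 0↝u

path-runStarts≤length : ∀ {m} {Is It : Subset m} {ℓ} → ReconfSeq (PathGraph m) Is It ℓ →
  ∣ runStarts false (Is △ It) ∣ ≤ ℓ
path-runStarts≤length {m} = potential≤length (∣_∣ ∘ runStarts false)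
  (trans (cong ∣_∣ (runStarts-∅ {m} false)) (∣⊥∣≡0 m))
  λ X D connected → ≤-trans (∣runStarts-△∣≤ X D) (+-monoʳ-≤ _ (path-runStarts≤1 connected))

cycle-runStarts≤length : ∀ {m} {Is It : Subset (suc m)} {ℓ} → ReconfSeq (CycleGraph (suc m)) Is It ℓ →
  ∣ cyclicRunStarts (Is △ It) ∣ ≤ ℓ
cycle-runStarts≤length {m} = potential≤length (∣_∣ ∘ cyclicRunStarts)
  (trans (cong ∣_∣ (runStarts-∅ {suc m} false)) (∣⊥∣≡0 (suc m)))
  λ X D connected → ≤-trans (∣cyclicRunStarts-△∣≤ X D) (+-monoʳ-≤ _ (cycle-runStarts≤1 connected))

-- Switching the components one at a time

module Interpolation {n k} {G : Graph n} {Is It : Subset n}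
  (Is-ind : Independent G Is) (It-ind : Independent G It) (cc : HasCC G (Is △ It) k) where

  S = Is △ It
  label = proj₁ cc

  same-label⇔reach : ∀ u v → u ∈ S → v ∈ S → (label u ≡ label v ⇔ Reach G S u v)
  same-label⇔reach = proj₁ (proj₂ cc)

  switched : ℕ → Fin n → Bool
  switched j v = toℕ (label v) <ᵇ j

  stage : ℕ → Subset n
  stage j = tabulate λ v → if switched j v then lookup It v else lookup Is v

  lookup-stage : ∀ j v → lookup (stage j) v ≡ (if switched j v then lookup It v else lookup Is v)
  lookup-stage j = lookup∘tabulate _

  stage-0 : stage 0 ≡ Is
  stage-0 = tabulate∘lookup Is

  stage-k : stage k ≡ It
  stage-k = trans (tabulate-cong λ v → cong (if_then lookup It v else lookup Is v) all-switched)
                  (tabulate∘lookup It)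
    where
    all-switched : ∀ {v} → switched k v ≡ true
    all-switched {v} = Equivalence.to T-≡ (<⇒<ᵇ (toℕ<n (label v)))

  ∈-stage⁻ : ∀ j {v} → v ∈ stage j → (switched j v ≡ true × v ∈ It) ⊎ (switched j v ≡ false × v ∈ Is)
  ∈-stage⁻ j {v} v∈ with switched j v | lookup-stage j v
  ... | true  | eq = inj₁ (refl , lookup⇒[]= v It (trans (sym eq) ([]=⇒lookup v∈)))
  ... | false | eq = inj₂ (refl , lookup⇒[]= v Is (trans (sym eq) ([]=⇒lookup v∈)))

  switch-boundary : ∀ j {u v} → switched j u ≡ true → u ∈ It → switched j v ≡ false → v ∈ Is →
    Adj G u v ⊎ Adj G v u → ⊥
  switch-boundary j {u} {v} u-switched u∈It v-unswitched v∈Is adj with v ∈? It | u ∈? Is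
  ... | yes v∈It | _ = [ It-ind u v u∈It v∈It , It-ind v u v∈It u∈It ] adj
  ... | no _ | yes u∈Is = [ Is-ind u v u∈Is v∈Is , Is-ind v u v∈Is u∈Is ] adj
  ... | no v∉It | no u∉Is =
    true≢false (trans (sym u-switched) (trans (cong (λ a → toℕ a <ᵇ j) same-label) v-unswitched))
    where
    u∈S = ∈-△⁺ʳ u∉Is u∈It
    v∈S = ∈-△⁺ˡ v∈Is v∉It
    same-label : label u ≡ label v
    same-label = [ (λ a → Equivalence.from (same-label⇔reach u v u∈S v∈S) (step (here u∈S) a v∈S))
                 , (λ a → sym (Equivalence.from (same-label⇔reach v u v∈S u∈S) (step (here v∈S) a u∈S))) ] adj

  stage-independent : ∀ j → Independent G (stage j)
  stage-independent j u v u∈ v∈ adj with ∈-stage⁻ j u∈ | ∈-stage⁻ j v∈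
  ... | inj₁ (_ , u∈It) | inj₁ (_ , v∈It) = It-ind u v u∈It v∈It adj
  ... | inj₂ (_ , u∈Is) | inj₂ (_ , v∈Is) = Is-ind u v u∈Is v∈Is adj
  ... | inj₁ (u-sw , u∈It) | inj₂ (v-sw , v∈Is) = switch-boundary j u-sw u∈It v-sw v∈Is (inj₁ adj)
  ... | inj₂ (u-sw , u∈Is) | inj₁ (v-sw , v∈It) = switch-boundary j v-sw v∈It u-sw u∈Is (inj₂ adj)

  lookup-stage-△ : ∀ j v → lookup (stage j △ stage (suc j)) v ≡ (toℕ (label v) ≡ᵇ j) ∧ lookup S v
  lookup-stage-△ j v = begin
    lookup (stage j △ stage (suc j)) v
      ≡⟨ trans (lookup-△ (stage j) (stage (suc j)) v) (cong₂ _xor_ (lookup-stage j v) (lookup-stage (suc j) v)) ⟩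
    (if switched j v then lookup It v else lookup Is v) xor (if switched (suc j) v then lookup It v else lookup Is v)
      ≡⟨ if-xor (switched j v) (switched (suc j) v) (lookup Is v) (lookup It v) ⟩
    (switched j v xor switched (suc j) v) ∧ (lookup Is v xor lookup It v)
      ≡⟨ cong₂ _∧_ (<ᵇ-xor-<ᵇ-suc (toℕ (label v)) j) (sym (lookup-△ Is It v)) ⟩
    (toℕ (label v) ≡ᵇ j) ∧ lookup S v
      ∎
    where open ≡-Reasoning

  ∈-stage-△⁻ : ∀ j {v} → v ∈ stage j △ stage (suc j) → v ∈ S × toℕ (label v) ≡ j
  ∈-stage-△⁻ j {v} v∈ with ∧≡true⁻ (trans (sym (lookup-stage-△ j v)) ([]=⇒lookup v∈))
  ... | label≡j , v∈S = lookup⇒[]= v S v∈S , ≡ᵇ⇒≡ _ j (Equivalence.from T-≡ label≡j)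

  ∈-stage-△⁺ : ∀ j {v} → v ∈ S → toℕ (label v) ≡ j → v ∈ stage j △ stage (suc j)
  ∈-stage-△⁺ j {v} v∈S label≡j = lookup⇒[]= v (stage j △ stage (suc j))
    (trans (lookup-stage-△ j v)
           (cong₂ _∧_ (Equivalence.to T-≡ (≡⇒≡ᵇ _ j label≡j)) ([]=⇒lookup v∈S)))

  stage-step-connected : ∀ j → Connected G (stage j △ stage (suc j))
  stage-step-connected j u v u∈ v∈ with ∈-stage-△⁻ j u∈ | ∈-stage-△⁻ j v∈
  ... | u∈S , u-label | v∈S , v-label =
    reach-restrict within
      (Equivalence.to (same-label⇔reach u v u∈S v∈S) (toℕ-injective (trans u-label (sym v-label))))
    where
    within : ∀ {w} → Reach G S u w → w ∈ stage j △ stage (suc j)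
    within {w} r = ∈-stage-△⁺ j (reach-target r)
      (trans (cong toℕ (sym (Equivalence.from (same-label⇔reach u w u∈S (reach-target r)) r))) u-label)

  reconfiguration : ReconfSeq G Is It k
  reconfiguration = subst₂ (λ A B → ReconfSeq G A B k) stage-0 stage-k
    (ReconfSeq-stages stage stage-independent stage-step-connected k)

open Interpolation using (reconfiguration)

theorem29 : ∀ {n} (G : Graph n) → IsPathOrCycle G →
    (Is It : Subset n) → Independent G Is → Independent G It →
    (k : ℕ) → HasCC G (Is △ It) k →
    ReconfSeq G Is It k × (∀ ℓ → ReconfSeq G Is It ℓ → k ≤ ℓ)
theorem29 G (isPath n) Is It Is-ind It-ind k cc =
  reconfiguration Is-ind It-ind cc , λ ℓ seq → ≤-trans (path-cc≤runStarts cc) (path-runStarts≤length seq)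
theorem29 G (isCycle zero ()) Is It Is-ind It-ind k cc
theorem29 G (isCycle (suc m) _) Is It Is-ind It-ind k cc =
  reconfiguration Is-ind It-ind cc , λ ℓ seq →
    [ (λ k≤runs → ≤-trans k≤runs (cycle-runStarts≤length seq))
    , (λ k≤1 → cc≤1⇒cc≤length cc k≤1 seq) ] (cycle-cc≤runStarts cc)
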